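{- Let $(G,r)$ be a rooted graph (with $G$ finite, connected, undirected and loop-free) and let $\lambda : E(G) \to 2^{\mathbb{N}}$ be any time-labelling function. Any strategy $S = v_1,\dots,v_\ell$ for \textsc{Firefighter} on $(G,r)$ is also a valid strategy for \textsc{Temporal Firefighter} on the rooted temporal graph $((G,\lambda),r)$. Furthermore, any vertex saved by $S$ in \textsc{Firefighter} on $(G,r)$ is also saved by $S$ in \textsc{Temporal Firefighter} on $((G,\lambda),r)$.
   Context: \textsc{Firefighter} on a rooted graph $(G,r)$: at time $t=0$ the root $r$ is burning; at each time $t \ge 1$ a chosen vertex is labelled defended, and then the fire spreads from every burning vertex to all adjacent vertices that are neither burning nor defended; the process ends once the fire can no longer spread. A vertex is a valid defence on timestep $i$ if it is neither burning nor already defended at that point. A strategy is a sequence of vertices $v_1,\dots,v_\ell$ such that each $v_i$ is a valid defence on timestep $i$ (no vertex is defended after timestep $\ell$). A vertex is saved if it is not burning when the process ends. A temporal graph is a pair $(G,\lambda)$ with $G=(V,E)$ a static graph and $\lambda: E \to 2^{\mathbb{N}}$ assigning to each edge the set of timesteps at which it is active. Two adjacent vertices $u,v$ are temporally adjacent at time $t$ if $t \in \lambda(uv)$. \textsc{Temporal Firefighter} on a rooted temporal graph $((G,\lambda),r)$ is the same process as \textsc{Firefighter}, except that at time $t$ the fire spreads from each burning vertex only to those neither burning nor defended vertices that are temporally adjacent to it at time $t$. Valid defences, strategies and saved vertices are defined as for \textsc{Firefighter}. -}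

module Defs where

open import Data.Nat using (ℕ; zero; suc; _<_)
open import Data.Fin using (Fin; toℕ)
open import Data.Bool using (Bool; true; false; _∧_)
open import Data.List using (List; length; lookup)
open import Data.Product using (Σ; _×_)
open import Relation.Binary.PropositionalEquality using (_≡_)
open import Relation.Nullary using (¬_)

data Walk {n : ℕ} (adj : Fin n → Fin n → Bool) : Fin n → Fin n → Set where
  here : ∀ {v} → Walk adj v v
  step : ∀ {u w v} → adj u w ≡ true → Walk adj w v → Walk adj u v

record Graph (n : ℕ) : Set where
  field
    adj       : Fin n → Fin n → Bool
    symmetric : ∀ u v → adj u v ≡ adj v u
    loopFree  : ∀ v → adj v v ≡ false
    connected : ∀ u v → Walk adj u v
open Graph public

-- The set of times at which edge uv is
-- active is {t | label u v t ≡ true}; the labelling is symmetric so it is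
-- a function of the undirected edge.  Its values on non-edges are irrelevant
-- (they are always masked by adjacency).
record TimeLabelling {n : ℕ} (G : Graph n) : Set where
  field
    label    : Fin n → Fin n → ℕ → Bool
    labelSym : ∀ u v t → label u v t ≡ label v u t
open TimeLabelling public

Activity : ℕ → Set
Activity n = ℕ → Fin n → Fin n → Bool

staticAct : ∀ {n} → Graph n → Activity n
staticAct G t u v = adj G u v

temporalAct : ∀ {n} (G : Graph n) → TimeLabelling G → Activity n
temporalAct G lam t u v = adj G u v ∧ label lam u v t

-- A strategy is a list S = v_1 … v_ℓ (stored 0-indexed: v_{i+1} = lookup S i).
-- Vertex v is defended at time t (after the defence of timestep t) iff
-- v = v_j for some 1 ≤ j ≤ min(t, ℓ).
Defended : ∀ {n} → List (Fin n) → ℕ → Fin n → Set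
Defended S t v = Σ (Fin (length S)) λ i → (toℕ i < t) × (lookup S i ≡ v)

-- Burning act r S t v : v is burning at the end of timestep t
-- (root burns at time 0; at time t+1 first v_{t+1} is defended, then the fire
-- spreads along edges active at time t+1 to non-defended vertices).
data Burning {n : ℕ} (act : Activity n) (r : Fin n) (S : List (Fin n))
     : ℕ → Fin n → Set where
  root   : Burning act r S 0 r
  stay   : ∀ {t v} → Burning act r S t v → Burning act r S (suc t) v
  spread : ∀ {t u v} → Burning act r S t u → act (suc t) u v ≡ true →
           ¬ Defended S (suc t) v → Burning act r S (suc t) v

-- v_{i+1} (defended at timestep i+1) is valid: neither burning nor defended
-- at the end of timestep i.
IsStrategy : ∀ {n} → Activity n → Fin n → List (Fin n) → Set
IsStrategy act r S = ∀ (i : Fin (length S)) →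
  ¬ Burning act r S (toℕ i) (lookup S i) × ¬ Defended S (toℕ i) (lookup S i)

-- Saved: never burning (burning sets only grow, so this is "not burning when
-- the process ends").
Saved : ∀ {n} → Activity n → Fin n → List (Fin n) → Fin n → Set
Saved act r S v = ∀ t → ¬ Burning act r S t v

{-# OPTIONS --safe #-}
-- Restricting when edges are active can only shrink the set of burning
-- vertices at every timestep, so every defence that was valid stays valid and
-- every vertex that was never reached stays unreached.  The temporal game is
-- such a restriction of the static one: uv is active at t only if t ∈ λ(uv).
module Submission where

open import Defs
open import Data.Nat using (ℕ)
open import Data.Fin using (Fin)
open import Data.List using (List)
open import Data.Product using (_×_; _,_)
open import Data.Bool using (Bool; true; _∧_)
open import Relation.Binary.PropositionalEquality using (_≡_; refl)

_⊆ᵃ_ : ∀ {n} → Activity n → Activity n → Set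
act ⊆ᵃ act′ = ∀ {t u v} → act t u v ≡ true → act′ t u v ≡ true

∧-trueˡ : ∀ {a b : Bool} → a ∧ b ≡ true → a ≡ true
∧-trueˡ {true} _ = refl

temporal⊆static : ∀ {n} (G : Graph n) (lam : TimeLabelling G) →
  temporalAct G lam ⊆ᵃ staticAct G
temporal⊆static G lam = ∧-trueˡ

Burning-mono : ∀ {n} {act act′ : Activity n} {r S t v} → act ⊆ᵃ act′ →
  Burning act r S t v → Burning act′ r S t v
Burning-mono sub root = root
Burning-mono sub (stay b) = stay (Burning-mono sub b)
Burning-mono sub (spread b e nd) = spread (Burning-mono sub b) (sub e) nd

IsStrategy-antimono : ∀ {n} {act act′ : Activity n} {r S} → act ⊆ᵃ act′ →
  IsStrategy act′ r S → IsStrategy act r S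
IsStrategy-antimono sub valid i =
  let (unburnt , undefended) = valid i in
  (λ b → unburnt (Burning-mono sub b)) , undefended

Saved-antimono : ∀ {n} {act act′ : Activity n} {r S v} → act ⊆ᵃ act′ →
  Saved act′ r S v → Saved act r S v
Saved-antimono sub saved t b = saved t (Burning-mono sub b)

mainTheorem1 : ∀ {n : ℕ} (G : Graph n) (r : Fin n) (lam : TimeLabelling G) (S : List (Fin n)) →
    IsStrategy (staticAct G) r S →
    IsStrategy (temporalAct G lam) r S
      × (∀ v → Saved (staticAct G) r S v → Saved (temporalAct G lam) r S v)
mainTheorem1 G r lam S valid =
  IsStrategy-antimono sub valid , λ v → Saved-antimono sub
  where
  sub : temporalAct G lam ⊆ᵃ staticAct G
  sub = temporal⊆static G lam
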